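{- Let $k$ be a positive integer. For $n\ge 0$ let $$c_n^{(k)}=\int_0^1\cdots\int_0^1 (x_1x_2\cdots x_k)_n\,dx_1\cdots dx_k,\qquad \widehat c_n^{(k)}=(-1)^n\int_0^1\cdots\int_0^1 \langle x_1x_2\cdots x_k\rangle_n\,dx_1\cdots dx_k$$ ($k$-fold integrals over $[0,1]^k$), and put $\sigma_n^{(k)}=(-1)^{n-1}c_n^{(k)}$ and $\omega_n^{(k)}=(-1)^n\widehat c_n^{(k)}$. Then the sequences $\{\sigma_n^{(k)}\}_{n\ge 2}$ and $\{\omega_n^{(k)}\}_{n\ge 0}$ are log-convex. Equivalently, $\big(c_n^{(k)}\big)^2\le c_{n-1}^{(k)}c_{n+1}^{(k)}$ for all $n\ge 3$, and $\big(\widehat c_n^{(k)}\big)^2\le \widehat c_{n-1}^{(k)}\widehat c_{n+1}^{(k)}$ for all $n\ge 1$.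
   Context: Here $(x)_n=x(x-1)\cdots(x-n+1)$ for $n\ge1$ with $(x)_0=1$ (falling factorial), and $\langle x\rangle_n=x(x+1)\cdots(x+n-1)$ for $n\ge 1$ with $\langle x\rangle_0=1$ (rising factorial). The numbers $c_n^{(k)}$ and $\widehat c_n^{(k)}$ are the poly-Cauchy numbers of the first and second kind. A sequence $\{z_n\}_{n\ge n_0}$ of positive numbers is called log-convex if $z_j^2\le z_{j-1}z_{j+1}$ for all $j\ge n_0+1$. -}

module Defs where

open import Data.Nat using (ℕ; zero; suc)
open import Data.Integer using (+_)
open import Data.Rational using (ℚ; 0ℚ; 1ℚ; _+_; _*_; -_; _≤_; _<_; _/_)
open import Data.List using (List; []; _∷_; map)
open import Data.Product using (_×_)

-- Polynomials in one variable t over ℚ, as coefficient lists: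
-- [a₀, a₁, …] represents a₀ + a₁ t + a₂ t² + …
Poly : Set
Poly = List ℚ

addP : Poly → Poly → Poly
addP []       q        = q
addP (a ∷ p)  []       = a ∷ p
addP (a ∷ p)  (b ∷ q)  = (a + b) ∷ addP p q

mulLin : ℚ → Poly → Poly
mulLin a p = addP (0ℚ ∷ p) (map (λ c → a * c) p)

nℚ : ℕ → ℚ
nℚ n = + n / 1

falling : ℕ → Poly
falling zero    = 1ℚ ∷ []
falling (suc n) = mulLin (- nℚ n) (falling n)

rising : ℕ → Poly
rising zero    = 1ℚ ∷ []
rising (suc n) = mulLin (nℚ n) (rising n)

pow : ℚ → ℕ → ℚ
pow q zero    = 1ℚ
pow q (suc k) = q * pow q k

-- ∫_{[0,1]^k} (x₁x₂⋯x_k)^i dx₁⋯dx_k = (1/(i+1))^k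
monoInt : ℕ → ℕ → ℚ
monoInt k i = pow (+ 1 / suc i) k

-- ∫_{[0,1]^k} p(x₁x₂⋯x_k) dx₁⋯dx_k, by linearity; the coefficient list
-- is read starting at degree i
intFrom : ℕ → ℕ → Poly → ℚ
intFrom k i []       = 0ℚ
intFrom k i (c ∷ cs) = c * monoInt k i + intFrom k (suc i) cs

integral : ℕ → Poly → ℚ
integral k p = intFrom k 0 p

sgn : ℕ → ℚ
sgn zero    = 1ℚ
sgn (suc n) = - sgn n

polyCauchy₁ : ℕ → ℕ → ℚ
polyCauchy₁ k n = integral k (falling n)

polyCauchy₂ : ℕ → ℕ → ℚ
polyCauchy₂ k n = sgn n * integral k (rising n)

-- σ_n^{(k)} = (-1)^{n-1} c_n^{(k)}  (= - (-1)^n c_n^{(k)})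
σ : ℕ → ℕ → ℚ
σ k n = - (sgn n * polyCauchy₁ k n)

ω : ℕ → ℕ → ℚ
ω k n = sgn n * polyCauchy₂ k n

-- {z_n}_{n ≥ n₀} is a log-convex sequence of positive numbers:
-- z_n > 0 for n ≥ n₀, and z_j² ≤ z_{j-1} z_{j+1} for all j ≥ n₀+1
-- (written with j = suc i, i ≥ n₀).
LogConvexFrom : ℕ → (ℕ → ℚ) → Set
LogConvexFrom n₀ z =
  (∀ n → n₀ Data.Nat.≤ n → 0ℚ < z n) ×
  (∀ i → n₀ Data.Nat.≤ i → z (suc i) * z (suc i) ≤ z i * z (suc (suc i)))

{-# OPTIONS --safe #-}
-- Write L_k(p) = ∫_{[0,1]^k} p(x₁⋯x_k), so that L_k(yˡ) = (l+1)^{-k}.  For k ≥ 1 all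
-- L_k(yⁱ(1−y)ʲ) are positive, by induction on k and j from the integration by parts
--   (i+1) L_{k+1}(yⁱ(1−y)^{j+1}) = L_k(yⁱ(1−y)^{j+1}) + (j+1) L_{k+1}(y^{i+1}(1−y)ʲ).
-- As (−1)^{n−1}(y)ₙ = y(1−y)(2−y)⋯(n−1−y) for n ≥ 1 and n − y = (n−1) + (1−y), the
-- values of L_k at yⁱ(−1)^{n−1}(y)ₙ and at yⁱ⟨y⟩ₙ are then positive as well.  For three
-- consecutive terms x, y, z of σ or ω, the recurrences of the factorials give
-- c x = y + a and z = c y + b with a, b ≥ 0, whence x z = y² + a y + b x ≥ y².
module Submission where

open import Defs
open import Data.Nat using (ℕ; _≤_)
open import Data.Product using (_×_)

open import Data.Nat using (zero; suc; z≤n; s≤s)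
open import Data.Nat.Properties using (≤-trans)
import Data.Nat.Coprimality as Coprime
import Data.Integer as ℤ
import Data.Integer.Properties as ℤ
open import Data.List using ([]; _∷_; map)
open import Data.Product using (_,_)
open import Data.Rational as ℚ using (ℚ; mkℚ; 0ℚ; 1ℚ; _+_; _*_; -_; _-_; _/_; _<_)
import Data.Rational.Properties as ℚ
open import Level using (0ℓ)
open import Relation.Nullary.Decidable using (dec⇒maybe)
open import Relation.Binary.PropositionalEquality
  using (_≡_; refl; sym; trans; cong; cong₂; subst; subst₂; module ≡-Reasoning)
open import Tactic.RingSolver using (solve-∀)
open import Tactic.RingSolver.Core.AlmostCommutativeRing
  using (AlmostCommutativeRing; fromCommutativeRing)

-- The solver needs an exact zero test to cancel coefficients in normal forms.
ℚ-ring : AlmostCommutativeRing 0ℓ 0ℓ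
ℚ-ring = fromCommutativeRing ℚ.+-*-commutativeRing (λ q → dec⇒maybe (0ℚ ℚ.≟ q))

private
  variable
    a b c x y z : ℚ
    μ d e : ℕ → ℚ

x-y+y≡x : ∀ x y → x - y + y ≡ x
x-y+y≡x = solve-∀ ℚ-ring

≥0+≥0 : 0ℚ ℚ.≤ a → 0ℚ ℚ.≤ b → 0ℚ ℚ.≤ a + b
≥0+≥0 = ℚ.+-mono-≤

≥0+>0 : 0ℚ ℚ.≤ a → 0ℚ < b → 0ℚ < a + b
≥0+>0 = ℚ.+-mono-≤-<

≥0*≥0 : 0ℚ ℚ.≤ a → 0ℚ ℚ.≤ b → 0ℚ ℚ.≤ a * b
≥0*≥0 {a} {b} a≥0 b≥0 = ℚ.nonNegative⁻¹ (a * b)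
  {{ℚ.nonNeg*nonNeg⇒nonNeg a {{ℚ.nonNegative a≥0}} b {{ℚ.nonNegative b≥0}}}}

>0*>0 : 0ℚ < a → 0ℚ < b → 0ℚ < a * b
>0*>0 {a} {b} a>0 b>0 = ℚ.positive⁻¹ (a * b)
  {{ℚ.pos*pos⇒pos a {{ℚ.positive a>0}} b {{ℚ.positive b>0}}}}

>0-cancelˡ-* : 0ℚ < c → 0ℚ < c * x → 0ℚ < x
>0-cancelˡ-* {c} {x} c>0 cx>0 = ℚ.*-cancelˡ-<-nonNeg c {{ℚ.nonNegative (ℚ.<⇒≤ c>0)}}
  (subst (_< c * x) (sym (ℚ.*-zeroʳ c)) cx>0)

nℚ≡mkℚ : ∀ n → nℚ n ≡ mkℚ (ℤ.+ n) 0 (Coprime.sym (Coprime.1-coprimeTo n))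
nℚ≡mkℚ n = ℚ.normalize-coprime (Coprime.sym (Coprime.1-coprimeTo n))

nℚ-suc : ∀ n → nℚ (suc n) ≡ 1ℚ + nℚ n
nℚ-suc n = begin
  nℚ (suc n)
    ≡⟨ ℚ./-cong (cong (λ m → ℤ.+ 1 ℤ.+ m) (sym (ℤ.*-identityʳ (ℤ.+ n)))) refl ⟩
  1ℚ + mkℚ (ℤ.+ n) 0 (Coprime.sym (Coprime.1-coprimeTo n))
    ≡⟨ cong (λ q → 1ℚ + q) (sym (nℚ≡mkℚ n)) ⟩
  1ℚ + nℚ n ∎
  where open ≡-Reasoning

nℚ≥0 : ∀ n → 0ℚ ℚ.≤ nℚ n
nℚ≥0 n = ℚ.nonNegative⁻¹ _ {{ℚ.normalize-nonNeg n 1}}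

nℚ>0 : ∀ n → 0ℚ < nℚ (suc n)
nℚ>0 n = ℚ.positive⁻¹ _ {{ℚ.normalize-pos (suc n) 1}}

nℚ*inverse : ∀ i → nℚ (suc i) * (ℤ.+ 1 / suc i) ≡ 1ℚ
nℚ*inverse i =
  trans (cong₂ _*_ (nℚ≡mkℚ (suc i)) (ℚ.normalize-coprime (Coprime.1-coprimeTo (suc i))))
        (ℚ.*-inverseʳ (mkℚ (ℤ.+ suc i) 0 (Coprime.sym (Coprime.1-coprimeTo (suc i)))))

sgn-sgn : ∀ n q → sgn n * (sgn n * q) ≡ q
sgn-sgn zero    q = trans (ℚ.*-identityˡ _) (ℚ.*-identityˡ q)
sgn-sgn (suc n) q = trans (neg-neg (sgn n) q) (sgn-sgn n q)
  where
  neg-neg : ∀ s q → - s * (- s * q) ≡ s * (s * q)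
  neg-neg = solve-∀ ℚ-ring

pow>0 : 0ℚ < c → ∀ k → 0ℚ < pow c k
pow>0 c>0 zero    = ℚ.positive⁻¹ 1ℚ
pow>0 c>0 (suc k) = >0*>0 c>0 (pow>0 c>0 k)

-- If μ l is the moment L(yˡ) of a linear functional L, then Δ^ j μ i = L(yⁱ(1−y)ʲ).
Δ : (ℕ → ℚ) → ℕ → ℚ
Δ μ i = μ i - μ (suc i)

Δ^ : ℕ → (ℕ → ℚ) → ℕ → ℚ
Δ^ zero    μ = μ
Δ^ (suc j) μ = Δ (Δ^ j μ)

CompletelyMonotone : (ℕ → ℚ) → Set
CompletelyMonotone μ = ∀ j i → 0ℚ ℚ.≤ Δ^ j μ i

StrictlyCompletelyMonotone : (ℕ → ℚ) → Set
StrictlyCompletelyMonotone μ = ∀ j i → 0ℚ < Δ^ j μ i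

Δ^-Δ : ∀ j μ i → Δ^ j (Δ μ) i ≡ Δ^ (suc j) μ i
Δ^-Δ zero    μ i = refl
Δ^-Δ (suc j) μ i = cong₂ _-_ (Δ^-Δ j μ i) (Δ^-Δ j μ (suc i))

Δ-strictlyCompletelyMonotone : StrictlyCompletelyMonotone μ → StrictlyCompletelyMonotone (Δ μ)
Δ-strictlyCompletelyMonotone μ-scm j i = subst (0ℚ <_) (sym (Δ^-Δ j _ i)) (μ-scm (suc j) i)

Δ^-const : ∀ c j i → Δ^ (suc j) (λ _ → c) i ≡ 0ℚ
Δ^-const c zero    i = ℚ.+-inverseʳ c
Δ^-const c (suc j) i = cong₂ _-_ (Δ^-const c j i) (Δ^-const c j (suc i))

const-completelyMonotone : 0ℚ ℚ.≤ c → CompletelyMonotone (λ _ → c)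
const-completelyMonotone     c≥0 zero    i = c≥0
const-completelyMonotone {c} c≥0 (suc j) i = ℚ.≤-reflexive (sym (Δ^-const c j i))

-- A discrete Leibniz rule; for d = monoInt k and e = monoInt (k + 1) it is the
-- integration by parts identity of L_{k+1}.
Δ^-weighted : (∀ i → d i ≡ nℚ (suc i) * e i) → ∀ j i →
  Δ^ (suc j) d i ≡ nℚ (suc i) * Δ^ (suc j) e i - nℚ (suc j) * Δ^ j e (suc i)
Δ^-weighted {d} {e} d≡ zero i = begin
  d i - d (suc i)
    ≡⟨ cong₂ _-_ (d≡ i) (d≡ (suc i)) ⟩
  nℚ (suc i) * e i - nℚ (suc (suc i)) * e (suc i)
    ≡⟨ cong (λ t → nℚ (suc i) * e i - t * e (suc i)) (nℚ-suc (suc i)) ⟩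
  nℚ (suc i) * e i - (1ℚ + nℚ (suc i)) * e (suc i)
    ≡⟨ regroup (nℚ (suc i)) (e i) (e (suc i)) ⟩
  nℚ (suc i) * (e i - e (suc i)) - nℚ 1 * e (suc i) ∎
  where
  open ≡-Reasoning
  regroup : ∀ c a b → c * a - (1ℚ + c) * b ≡ c * (a - b) - 1ℚ * b
  regroup = solve-∀ ℚ-ring
Δ^-weighted {d} {e} d≡ (suc j) i = begin
  Δ^ (suc j) d i - Δ^ (suc j) d (suc i)
    ≡⟨ cong₂ _-_ (Δ^-weighted d≡ j i) (Δ^-weighted d≡ j (suc i)) ⟩
  (cᵢ * A - cⱼ * B) - (nℚ (suc (suc i)) * (B - B′) - cⱼ * B′)
    ≡⟨ cong (λ t → (cᵢ * A - cⱼ * B) - (t * (B - B′) - cⱼ * B′)) (nℚ-suc (suc i)) ⟩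
  (cᵢ * A - cⱼ * B) - ((1ℚ + cᵢ) * (B - B′) - cⱼ * B′)
    ≡⟨ regroup cᵢ cⱼ A B B′ ⟩
  cᵢ * (A - (B - B′)) - (1ℚ + cⱼ) * (B - B′)
    ≡⟨ cong (λ t → cᵢ * (A - (B - B′)) - t * (B - B′)) (sym (nℚ-suc (suc j))) ⟩
  nℚ (suc i) * Δ^ (suc (suc j)) e i - nℚ (suc (suc j)) * Δ^ (suc j) e (suc i) ∎
  where
  open ≡-Reasoning
  cᵢ cⱼ A B B′ : ℚ
  cᵢ = nℚ (suc i)
  cⱼ = nℚ (suc j)
  A  = Δ^ (suc j) e i
  B  = Δ^ j e (suc i)
  B′ = Δ^ j e (suc (suc i))
  regroup : ∀ c c′ a b b′ →
    (c * a - c′ * b) - ((1ℚ + c) * (b - b′) - c′ * b′) ≡ c * (a - (b - b′)) - (1ℚ + c′) * (b - b′)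
  regroup = solve-∀ ℚ-ring

weighted-strictlyCompletelyMonotone : CompletelyMonotone d → (∀ i → 0ℚ < e i) →
  (∀ i → d i ≡ nℚ (suc i) * e i) → StrictlyCompletelyMonotone e
weighted-strictlyCompletelyMonotone d-cm e>0 d≡ zero    i = e>0 i
weighted-strictlyCompletelyMonotone {d} {e} d-cm e>0 d≡ (suc j) i =
  >0-cancelˡ-* (nℚ>0 i) (subst (0ℚ <_) (sym by-parts)
    (≥0+>0 (d-cm (suc j) i)
           (>0*>0 (nℚ>0 j) (weighted-strictlyCompletelyMonotone d-cm e>0 d≡ j (suc i)))))
  where
  by-parts : nℚ (suc i) * Δ^ (suc j) e i ≡ Δ^ (suc j) d i + nℚ (suc j) * Δ^ j e (suc i)
  by-parts = sym (trans (cong (λ t → t + nℚ (suc j) * Δ^ j e (suc i)) (Δ^-weighted d≡ j i))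
                        (x-y+y≡x _ _))

monoInt>0 : ∀ k i → 0ℚ < monoInt k i
monoInt>0 k i = pow>0 (ℚ.positive⁻¹ _ {{ℚ.normalize-pos 1 (suc i)}}) k

monoInt-weighted : ∀ k i → monoInt k i ≡ nℚ (suc i) * monoInt (suc k) i
monoInt-weighted k i = sym (begin
  nℚ (suc i) * (u * pow u k) ≡⟨ sym (ℚ.*-assoc (nℚ (suc i)) u (pow u k)) ⟩
  nℚ (suc i) * u * pow u k   ≡⟨ cong (λ t → t * pow u k) (nℚ*inverse i) ⟩
  1ℚ * pow u k               ≡⟨ ℚ.*-identityˡ (pow u k) ⟩
  pow u k                    ∎)
  where
  open ≡-Reasoning
  u : ℚ
  u = ℤ.+ 1 / suc i

monoInt-strictlyCompletelyMonotone : ∀ k → StrictlyCompletelyMonotone (monoInt (suc k))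
monoInt-strictlyCompletelyMonotone zero = weighted-strictlyCompletelyMonotone
  (const-completelyMonotone (ℚ.nonNegative⁻¹ 1ℚ)) (monoInt>0 1) (monoInt-weighted 0)
monoInt-strictlyCompletelyMonotone (suc k) = weighted-strictlyCompletelyMonotone
  (λ j i → ℚ.<⇒≤ (monoInt-strictlyCompletelyMonotone k j i))
  (monoInt>0 (suc (suc k))) (monoInt-weighted (suc k))

-- moment μ i p = L(yⁱ p(y)) for the linear functional L with L(yˡ) = μ l.
moment : (ℕ → ℚ) → ℕ → Poly → ℚ
moment μ i []       = 0ℚ
moment μ i (c ∷ cs) = c * μ i + moment μ (suc i) cs

intFrom≡moment : ∀ k i p → intFrom k i p ≡ moment (monoInt k) i p
intFrom≡moment k i []       = refl
intFrom≡moment k i (c ∷ cs) = cong (λ t → c * monoInt k i + t) (intFrom≡moment k (suc i) cs)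

moment-addP : ∀ μ i p q → moment μ i (addP p q) ≡ moment μ i p + moment μ i q
moment-addP μ i []      q       = sym (ℚ.+-identityˡ _)
moment-addP μ i (a ∷ p) []      = sym (ℚ.+-identityʳ _)
moment-addP μ i (a ∷ p) (b ∷ q) =
  trans (cong (λ t → (a + b) * μ i + t) (moment-addP μ (suc i) p q)) (interchange a b (μ i) _ _)
  where
  interchange : ∀ a b m s t → (a + b) * m + (s + t) ≡ (a * m + s) + (b * m + t)
  interchange = solve-∀ ℚ-ring

moment-scale : ∀ μ i a p → moment μ i (map (λ c → a * c) p) ≡ a * moment μ i p
moment-scale μ i a []      = sym (ℚ.*-zeroʳ a)
moment-scale μ i a (c ∷ p) =
  trans (cong (λ t → a * c * μ i + t) (moment-scale μ (suc i) a p)) (factor a c (μ i) _)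
  where
  factor : ∀ a c m s → a * c * m + a * s ≡ a * (c * m + s)
  factor = solve-∀ ℚ-ring

moment-mulLin : ∀ μ i a p → moment μ i (mulLin a p) ≡ a * moment μ i p + moment μ (suc i) p
moment-mulLin μ i a p =
  trans (moment-addP μ i (0ℚ ∷ p) (map (λ c → a * c) p))
        (trans (cong (λ t → 0ℚ * μ i + moment μ (suc i) p + t) (moment-scale μ i a p))
               (regroup (μ i) (moment μ (suc i) p) (a * moment μ i p)))
  where
  regroup : ∀ m s t → 0ℚ * m + s + t ≡ t + s
  regroup = solve-∀ ℚ-ring

moment-Δ : ∀ μ i p → moment μ i p ≡ moment (Δ μ) i p + moment μ (suc i) p
moment-Δ μ i []      = refl
moment-Δ μ i (c ∷ p) =
  trans (cong (λ t → c * μ i + t) (moment-Δ μ (suc i) p)) (regroup c (μ i) (μ (suc i)) _ _)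
  where
  regroup : ∀ c m m′ s t → c * m + (s + t) ≡ (c * (m - m′) + s) + (c * m′ + t)
  regroup = solve-∀ ℚ-ring

fallingMoment : (ℕ → ℚ) → ℕ → ℕ → ℚ
fallingMoment μ n i = - (sgn n * moment μ i (falling n))

risingMoment : (ℕ → ℚ) → ℕ → ℕ → ℚ
risingMoment μ n i = moment μ i (rising n)

fallingMoment-suc : ∀ μ n i →
  fallingMoment μ (suc n) i ≡ nℚ n * fallingMoment μ n i - fallingMoment μ n (suc i)
fallingMoment-suc μ n i =
  trans (cong (λ t → - (- sgn n * t)) (moment-mulLin μ i (- nℚ n) (falling n)))
        (expand (sgn n) (nℚ n) _ _)
  where
  expand : ∀ s c m m′ → - (- s * (- c * m + m′)) ≡ c * - (s * m) - - (s * m′)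
  expand = solve-∀ ℚ-ring

fallingMoment-one : ∀ μ i → fallingMoment μ 1 i ≡ μ (suc i)
fallingMoment-one μ i =
  trans (fallingMoment-suc μ 0 i) (simplify (fallingMoment μ 0 i) (μ (suc i)))
  where
  simplify : ∀ f m → 0ℚ * f - - (1ℚ * (1ℚ * m + 0ℚ)) ≡ m
  simplify = solve-∀ ℚ-ring

fallingMoment-weighted : ∀ μ n i →
  nℚ n * fallingMoment μ n i ≡ fallingMoment μ (suc n) i + fallingMoment μ n (suc i)
fallingMoment-weighted μ n i = sym
  (trans (cong (λ t → t + fallingMoment μ n (suc i)) (fallingMoment-suc μ n i)) (x-y+y≡x _ _))

fallingMoment-Δ : ∀ μ n i →
  fallingMoment μ n i ≡ fallingMoment (Δ μ) n i + fallingMoment μ n (suc i)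
fallingMoment-Δ μ n i =
  trans (cong (λ t → - (sgn n * t)) (moment-Δ μ i (falling n))) (distrib (sgn n) _ _)
  where
  distrib : ∀ s m m′ → - (s * (m + m′)) ≡ - (s * m) + - (s * m′)
  distrib = solve-∀ ℚ-ring

-- The factor n + 1 − y of (y)_{n+2} written as n + (1 − y).
fallingMoment-suc-suc : ∀ μ n i →
  fallingMoment μ (suc (suc n)) i
    ≡ nℚ n * fallingMoment μ (suc n) i + fallingMoment (Δ μ) (suc n) i
fallingMoment-suc-suc μ n i = begin
  f (suc (suc n)) i                ≡⟨ fallingMoment-suc μ (suc n) i ⟩
  nℚ (suc n) * f (suc n) i - f′    ≡⟨ cong (λ t → t * f (suc n) i - f′) (nℚ-suc n) ⟩
  (1ℚ + nℚ n) * f (suc n) i - f′   ≡⟨ regroup (nℚ n) (f (suc n) i) f′ ⟩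
  nℚ n * f (suc n) i + (f (suc n) i - f′)
    ≡⟨ cong (λ t → nℚ n * f (suc n) i + (t - f′)) (fallingMoment-Δ μ (suc n) i) ⟩
  nℚ n * f (suc n) i + (fallingMoment (Δ μ) (suc n) i + f′ - f′)
    ≡⟨ cong (λ t → nℚ n * f (suc n) i + t) (x+y-y≡x _ f′) ⟩
  nℚ n * f (suc n) i + fallingMoment (Δ μ) (suc n) i ∎
  where
  open ≡-Reasoning
  f : ℕ → ℕ → ℚ
  f  = fallingMoment μ
  f′ : ℚ
  f′ = fallingMoment μ (suc n) (suc i)
  regroup : ∀ c x b → (1ℚ + c) * x - b ≡ c * x + (x - b)
  regroup = solve-∀ ℚ-ring
  x+y-y≡x : ∀ x y → x + y - y ≡ x
  x+y-y≡x = solve-∀ ℚ-ring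

fallingMoment>0 : StrictlyCompletelyMonotone μ → ∀ m i → 0ℚ < fallingMoment μ (suc m) i
fallingMoment>0 {μ} μ-scm zero i =
  subst (0ℚ <_) (sym (fallingMoment-one μ i)) (μ-scm 0 (suc i))
fallingMoment>0 {μ} μ-scm (suc m) i = subst (0ℚ <_) (sym (fallingMoment-suc-suc μ m i))
  (≥0+>0 (≥0*≥0 (nℚ≥0 m) (ℚ.<⇒≤ (fallingMoment>0 μ-scm m i)))
         (fallingMoment>0 (Δ-strictlyCompletelyMonotone μ-scm) m i))

risingMoment-suc : ∀ μ n i →
  risingMoment μ (suc n) i ≡ nℚ n * risingMoment μ n i + risingMoment μ n (suc i)
risingMoment-suc μ n i = moment-mulLin μ i (nℚ n) (rising n)

risingMoment-weighted : ∀ μ n i →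
  nℚ (suc n) * risingMoment μ n i ≡ risingMoment μ (suc n) i + risingMoment (Δ μ) n i
risingMoment-weighted μ n i = begin
  nℚ (suc n) * r n i                        ≡⟨ cong (λ t → t * r n i) (nℚ-suc n) ⟩
  (1ℚ + nℚ n) * r n i                       ≡⟨ distrib (nℚ n) (r n i) ⟩
  nℚ n * r n i + r n i
    ≡⟨ cong (λ t → nℚ n * r n i + t) (moment-Δ μ i (rising n)) ⟩
  nℚ n * r n i + (risingMoment (Δ μ) n i + r n (suc i))
    ≡⟨ regroup (nℚ n * r n i) (risingMoment (Δ μ) n i) (r n (suc i)) ⟩
  nℚ n * r n i + r n (suc i) + risingMoment (Δ μ) n i
    ≡⟨ cong (λ t → t + risingMoment (Δ μ) n i) (sym (risingMoment-suc μ n i)) ⟩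
  r (suc n) i + risingMoment (Δ μ) n i      ∎
  where
  open ≡-Reasoning
  r : ℕ → ℕ → ℚ
  r = risingMoment μ
  distrib : ∀ c x → (1ℚ + c) * x ≡ c * x + x
  distrib = solve-∀ ℚ-ring
  regroup : ∀ s a b → s + (a + b) ≡ s + b + a
  regroup = solve-∀ ℚ-ring

risingMoment>0 : (∀ i → 0ℚ < μ i) → ∀ n i → 0ℚ < risingMoment μ n i
risingMoment>0 {μ} μ>0 zero i = subst (0ℚ <_) (sym (simplify (μ i))) (μ>0 i)
  where
  simplify : ∀ m → 1ℚ * m + 0ℚ ≡ m
  simplify = solve-∀ ℚ-ring
risingMoment>0 {μ} μ>0 (suc n) i = subst (0ℚ <_) (sym (risingMoment-suc μ n i))
  (≥0+>0 (≥0*≥0 (nℚ≥0 n) (ℚ.<⇒≤ (risingMoment>0 μ>0 n i))) (risingMoment>0 μ>0 n (suc i)))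

square≤product : c * x ≡ y + a → z ≡ c * y + b →
  0ℚ ℚ.≤ a → 0ℚ ℚ.≤ b → 0ℚ ℚ.≤ x → 0ℚ ℚ.≤ y → y * y ℚ.≤ x * z
square≤product {c} {x} {y} {a} {z} {b} cx≡y+a z≡cy+b a≥0 b≥0 x≥0 y≥0 =
  subst₂ ℚ._≤_ (ℚ.+-identityʳ (y * y)) (sym xz≡)
    (ℚ.+-monoʳ-≤ (y * y) (≥0+≥0 (≥0*≥0 a≥0 y≥0) (≥0*≥0 b≥0 x≥0)))
  where
  open ≡-Reasoning
  expand : ∀ c x y b → x * (c * y + b) ≡ c * x * y + b * x
  expand = solve-∀ ℚ-ring
  regroup : ∀ y a b x → (y + a) * y + b * x ≡ y * y + (a * y + b * x)
  regroup = solve-∀ ℚ-ring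
  xz≡ : x * z ≡ y * y + (a * y + b * x)
  xz≡ = begin
    x * z                 ≡⟨ cong (x *_) z≡cy+b ⟩
    x * (c * y + b)       ≡⟨ expand c x y b ⟩
    c * x * y + b * x     ≡⟨ cong (λ t → t * y + b * x) cx≡y+a ⟩
    (y + a) * y + b * x   ≡⟨ regroup y a b x ⟩
    y * y + (a * y + b * x) ∎

LogConvexFrom-mono : ∀ {m n z} → m ≤ n → LogConvexFrom m z → LogConvexFrom n z
LogConvexFrom-mono m≤n (z>0 , z-lc) =
  (λ k n≤k → z>0 k (≤-trans m≤n n≤k)) , (λ k n≤k → z-lc k (≤-trans m≤n n≤k))

LogConvexFrom-cong : ∀ {n₀ z w} → (∀ n → z n ≡ w n) → LogConvexFrom n₀ z → LogConvexFrom n₀ w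
LogConvexFrom-cong z≡w (z>0 , z-lc) =
    (λ n n₀≤n → subst (0ℚ <_) (z≡w n) (z>0 n n₀≤n))
  , (λ i n₀≤i → subst₂ ℚ._≤_ (cong₂ _*_ (z≡w (suc i)) (z≡w (suc i)))
                              (cong₂ _*_ (z≡w i) (z≡w (suc (suc i)))) (z-lc i n₀≤i))

fallingMoments-logConvex : StrictlyCompletelyMonotone μ →
  LogConvexFrom 1 (λ n → fallingMoment μ n 0)
fallingMoments-logConvex {μ} μ-scm = positive , logConvex
  where
  f : ℕ → ℕ → ℚ
  f = fallingMoment μ
  f≥0 : ∀ m i → 0ℚ ℚ.≤ f (suc m) i
  f≥0 m i = ℚ.<⇒≤ (fallingMoment>0 μ-scm m i)
  positive : ∀ n → 1 ≤ n → 0ℚ < f n 0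
  positive (suc m) _ = fallingMoment>0 μ-scm m 0
  logConvex : ∀ i → 1 ≤ i → f (suc i) 0 * f (suc i) 0 ℚ.≤ f i 0 * f (suc (suc i)) 0
  logConvex (suc m) _ = square≤product {c = nℚ (suc m)}
    (fallingMoment-weighted μ (suc m) 0) (fallingMoment-suc-suc μ (suc m) 0)
    (f≥0 m 1) (ℚ.<⇒≤ (fallingMoment>0 (Δ-strictlyCompletelyMonotone μ-scm) (suc m) 0))
    (f≥0 m 0) (f≥0 (suc m) 0)

risingMoments-logConvex : StrictlyCompletelyMonotone μ →
  LogConvexFrom 0 (λ n → risingMoment μ n 0)
risingMoments-logConvex {μ} μ-scm = positive , logConvex
  where
  r : ℕ → ℕ → ℚ
  r = risingMoment μ
  r≥0 : ∀ {ν} → StrictlyCompletelyMonotone ν → ∀ n i → 0ℚ ℚ.≤ risingMoment ν n i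
  r≥0 ν-scm n i = ℚ.<⇒≤ (risingMoment>0 (ν-scm 0) n i)
  positive : ∀ n → 0 ≤ n → 0ℚ < r n 0
  positive n _ = risingMoment>0 (μ-scm 0) n 0
  logConvex : ∀ i → 0 ≤ i → r (suc i) 0 * r (suc i) 0 ℚ.≤ r i 0 * r (suc (suc i)) 0
  logConvex m _ = square≤product {c = nℚ (suc m)}
    (risingMoment-weighted μ m 0) (risingMoment-suc μ (suc m) 0)
    (r≥0 (Δ-strictlyCompletelyMonotone μ-scm) m 0) (r≥0 μ-scm (suc m) 1)
    (r≥0 μ-scm m 0) (r≥0 μ-scm (suc m) 0)

σ≡fallingMoment : ∀ k n → σ k n ≡ fallingMoment (monoInt k) n 0
σ≡fallingMoment k n = cong (λ t → - (sgn n * t)) (intFrom≡moment k 0 (falling n))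

ω≡risingMoment : ∀ k n → ω k n ≡ risingMoment (monoInt k) n 0
ω≡risingMoment k n = trans (sgn-sgn n _) (intFrom≡moment k 0 (rising n))

theorem2p1 : (k : ℕ) → 1 ≤ k →
    LogConvexFrom 2 (σ k) × LogConvexFrom 0 (ω k)
theorem2p1 zero ()
theorem2p1 (suc k) _ =
    LogConvexFrom-mono (s≤s z≤n)
      (LogConvexFrom-cong (λ n → sym (σ≡fallingMoment (suc k) n)) (fallingMoments-logConvex μ-scm))
  , LogConvexFrom-cong (λ n → sym (ω≡risingMoment (suc k) n)) (risingMoments-logConvex μ-scm)
  where
  μ-scm : StrictlyCompletelyMonotone (monoInt (suc k))
  μ-scm = monoInt-strictlyCompletelyMonotone k
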